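{- Let $D$ be a digraph whose linear-forest conflict graph $G^{\mathrm{lf}}_D$ is isomorphic to the cycle $C_n$ with $n\ge5$. Then the underlying graph of $D$ contains a cycle of length at least $3$. Moreover, if $D$ is a simple digraph, then $D$ must be an alternating closed trail (its edges, listed along the cycle $G^{\mathrm{lf}}_D\cong C_n$, form an alternating closed trail), so such a simple digraph exists only when $n$ is even.
   Context: A multidigraph $D$ consists of finite sets $V(D)$, $E(D)$ and maps $s,t:E(D)\to V(D)$ (source, target). Edges $e\neq f$ are parallel if $s(e)=s(f)$ and $t(e)=t(f)$; they form a $2$-cycle if $s(e)=t(f)$ and $s(f)=t(e)$. A digraph is a multidigraph without parallel edges; a simple digraph is a digraph with neither parallel edges nor $2$-cycles. The underlying graph of $D$ is the simple undirected graph on $V(D)$ in which $u\ne v$ are adjacent iff some edge of $D$ joins them. The linear-forest conflict graph $G^{\mathrm{lf}}_D$ is the simple graph with vertex set $E(D)$ in which distinct $e,f$ are adjacent iff $s(e)=s(f)$, or $t(e)=t(f)$, or $\{s(e),t(e)\}=\{s(f),t(f)\}$. An alternating closed trail is a cyclic sequence of distinct edges $e_0,\dots,e_{k-1},e_0$ such that for every $i$ (mod $k$), $s(e_i)=s(e_{i+1})$ or $t(e_i)=t(e_{i+1})$. -}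

module Defs where

open import Data.Nat using (ℕ; zero; suc; _≤_)
open import Data.Fin using (Fin; toℕ)
open import Data.Product using (Σ; _×_; ∃; ∃-syntax)
open import Data.Sum using (_⊎_)
open import Relation.Binary.PropositionalEquality using (_≡_; _≢_)
open import Relation.Nullary using (¬_)
open import Function.Definitions using (Injective)
open import Function.Bundles using (_⤖_; Bijection)

record Multidigraph : Set where
  field
    nv  : ℕ
    ne  : ℕ
    src : Fin ne → Fin nv
    tgt : Fin ne → Fin nv
open Multidigraph public

module _ (D : Multidigraph) where

  Parallel : Fin (ne D) → Fin (ne D) → Set
  Parallel e f = e ≢ f × src D e ≡ src D f × tgt D e ≡ tgt D f

  TwoCycle : Fin (ne D) → Fin (ne D) → Set
  TwoCycle e f = e ≢ f × src D e ≡ tgt D f × src D f ≡ tgt D e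

  IsDigraph : Set
  IsDigraph = ∀ e f → ¬ Parallel e f

  IsSimpleDigraph : Set
  IsSimpleDigraph = IsDigraph × (∀ e f → ¬ TwoCycle e f)

  UAdj : Fin (nv D) → Fin (nv D) → Set
  UAdj u v = u ≢ v × ∃[ e ] ((src D e ≡ u × tgt D e ≡ v) ⊎ (src D e ≡ v × tgt D e ≡ u))

  -- adjacency in the linear-forest conflict graph G^lf_D
  -- ({s e, t e} = {s f, t f} as sets, written out for 2-element multisets)
  LFAdj : Fin (ne D) → Fin (ne D) → Set
  LFAdj e f = e ≢ f ×
    (src D e ≡ src D f ⊎ tgt D e ≡ tgt D f ⊎
     ((src D e ≡ src D f × tgt D e ≡ tgt D f) ⊎ (src D e ≡ tgt D f × tgt D e ≡ src D f)))

Next : (k : ℕ) → Fin k → Fin k → Set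
Next k i j = suc (toℕ i) ≡ toℕ j ⊎ (suc (toℕ i) ≡ k × toℕ j ≡ 0)

CycAdj : (k : ℕ) → Fin k → Fin k → Set
CycAdj k i j = Next k i j ⊎ Next k j i

IsCycleIso : (D : Multidigraph) (n : ℕ) → Fin n ⤖ Fin (ne D) → Set
IsCycleIso D n σ = ∀ i j →
  (LFAdj D (Bijection.to σ i) (Bijection.to σ j) → CycAdj n i j) ×
  (CycAdj n i j → LFAdj D (Bijection.to σ i) (Bijection.to σ j))

HasUnderlyingCycle≥3 : Multidigraph → Set
HasUnderlyingCycle≥3 D =
  Σ ℕ λ k → 3 ≤ k × Σ (Fin k → Fin (nv D)) λ v →
    Injective _≡_ _≡_ v × (∀ i j → Next k i j → UAdj D (v i) (v j))

IsAltClosedTrail : (D : Multidigraph) (k : ℕ) → (Fin k → Fin (ne D)) → Set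
IsAltClosedTrail D k e =
  Injective _≡_ _≡_ e ×
  (∀ i j → Next k i j → src D (e i) ≡ src D (e j) ⊎ tgt D (e i) ≡ tgt D (e j))

module Submission where

-- Since the conflict graph is a cycle of length at least 5, it has no triangles and no 4-cycles,
-- and every edge of D conflicts with two others. Call a vertex pendant if it is a leaf of the
-- underlying graph joined to its neighbour by a 2-cycle of D. Counting conflicts shows that every
-- leaf is pendant and that the neighbour of a pendant vertex has two distinct non-pendant
-- neighbours. Hence every arc of the underlying graph ending at a non-pendant vertex continues,
-- without turning back, to another non-pendant vertex, and a non-backtracking walk in a finite
-- graph closes a cycle of length at least 3. If D has no 2-cycles, consecutive edges of the
-- conflict cycle share their source or their target; the two cases alternate, since equal cases
-- in a row would give a triangle, so the cycle has even length.

open import Defs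
open import Data.Bool using (Bool; not)
open import Data.Bool.Properties using (not-¬; not-involutive)
open import Data.Empty using (⊥; ⊥-elim)
open import Data.Fin using (Fin; zero; toℕ; fromℕ<)
open import Data.Fin.Properties using (_≟_; any?; all?; toℕ-injective; toℕ<n; toℕ-fromℕ<; <⇒notInjective)
open import Data.Nat using (ℕ; zero; suc; _+_; _≤_; _<_; z≤n; s≤s; z<s)
open import Data.Nat.Divisibility using (_∣_; _∣0; ∣-refl; ∣m∣n⇒∣m+n)
open import Data.Nat.GeneralisedArithmetic using (fold)
open import Data.Nat.Properties renaming (_≟_ to _≟ℕ_)
open import Data.Product using (Σ; ∃; ∃₂; _×_; _,_; proj₁; proj₂)
open import Data.Sum using (_⊎_; inj₁; inj₂)
open import Function.Bundles using (_⤖_; Bijection; Surjection)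
open import Function.Definitions using (Injective)
open import Relation.Nullary using (¬_; Dec; yes; no; does)
open import Relation.Nullary.Decidable using (_×-dec_; _⊎-dec_; _→-dec_; ¬?; decidable-stable)
open import Relation.Binary.PropositionalEquality

private
  variable
    m n : ℕ
    a b c d : Fin n

next : Fin n → Fin n
next {suc m} a with suc (toℕ a) ≟ℕ suc m
... | yes _      = zero
... | no 1+a≢1+m = fromℕ< (≤∧≢⇒< (toℕ<n a) 1+a≢1+m)

Next-next : (a : Fin n) → Next n a (next a)
Next-next {suc m} a with suc (toℕ a) ≟ℕ suc m
... | yes 1+a≡1+m = inj₂ (1+a≡1+m , refl)
... | no 1+a≢1+m  = inj₁ (sym (toℕ-fromℕ< (≤∧≢⇒< (toℕ<n a) 1+a≢1+m)))

Next-functional : Next n a b → Next n a c → b ≡ c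
Next-functional (inj₁ p) (inj₁ q) = toℕ-injective (trans (sym p) q)
Next-functional {b = b} (inj₁ p) (inj₂ (q , _)) = ⊥-elim (<-irrefl (trans (sym p) q) (toℕ<n b))
Next-functional {c = c} (inj₂ (p , _)) (inj₁ q) = ⊥-elim (<-irrefl (trans (sym q) p) (toℕ<n c))
Next-functional (inj₂ (_ , p)) (inj₂ (_ , q)) = toℕ-injective (trans p (sym q))

Next-injective : Next n a c → Next n b c → a ≡ b
Next-injective (inj₁ p) (inj₁ q) = toℕ-injective (suc-injective (trans p (sym q)))
Next-injective (inj₁ p) (inj₂ (_ , q)) with () ← trans p q
Next-injective (inj₂ (_ , p)) (inj₁ q) with () ← trans q p
Next-injective (inj₂ (p , _)) (inj₂ (q , _)) = toℕ-injective (suc-injective (trans p (sym q)))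

Next⇒≡next : Next n a b → b ≡ next a
Next⇒≡next p = Next-functional p (Next-next _)

Next⇒suc≡ : Next n a b → suc (toℕ a) ≡ toℕ b ⊎ suc (toℕ a) ≡ n + toℕ b
Next⇒suc≡ (inj₁ p) = inj₁ p
Next⇒suc≡ {n} (inj₂ (p , q)) = inj₂ (trans p (sym (trans (cong (n +_) q) (+-identityʳ n))))

next^ : ℕ → Fin n → Fin n
next^ k a = fold a next k

toℕ-next^ : (a : Fin n) (k : ℕ) → k ≤ n →
            toℕ a + k ≡ toℕ (next^ k a) ⊎ toℕ a + k ≡ n + toℕ (next^ k a)
toℕ-next^ a zero _ = inj₁ (+-identityʳ _)
toℕ-next^ {n} a (suc k) 1+k≤n =
  combine (toℕ-next^ a k (<⇒≤ 1+k≤n)) (Next⇒suc≡ (Next-next (next^ k a)))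
  where
  x = toℕ (next^ k a)
  y = toℕ (next^ (suc k) a)

  wrapped : ∀ {z} → toℕ a + k ≡ n + x → suc x ≡ z → toℕ a + suc k ≡ n + z
  wrapped {z} p q = begin
    toℕ a + suc k   ≡⟨ +-suc _ k ⟩
    suc (toℕ a + k) ≡⟨ cong suc p ⟩
    suc (n + x)     ≡⟨ +-suc n x ⟨
    n + suc x       ≡⟨ cong (n +_) q ⟩
    n + z           ∎
    where open ≡-Reasoning

  combine : toℕ a + k ≡ x ⊎ toℕ a + k ≡ n + x → suc x ≡ y ⊎ suc x ≡ n + y →
            toℕ a + suc k ≡ y ⊎ toℕ a + suc k ≡ n + y
  combine (inj₁ p) (inj₁ q) = inj₁ (trans (+-suc _ k) (trans (cong suc p) q))
  combine (inj₁ p) (inj₂ q) = inj₂ (trans (+-suc _ k) (trans (cong suc p) q))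
  combine (inj₂ p) (inj₁ q) = inj₂ (wrapped p q)
  combine (inj₂ p) (inj₂ q) = ⊥-elim (<⇒≱ (+-mono-<-≤ (toℕ<n a) 1+k≤n)
                                (subst (n + n ≤_) (sym (wrapped p q)) (+-monoʳ-≤ n (m≤m+n n _))))

next^n≡id : (a : Fin n) → next^ n a ≡ a
next^n≡id {n} a with toℕ-next^ a n ≤-refl
... | inj₁ eq = ⊥-elim (<⇒≱ (toℕ<n (next^ n a)) (subst (n ≤_) eq (m≤n+m n (toℕ a))))
... | inj₂ eq = toℕ-injective (+-cancelˡ-≡ n _ _ (trans (sym eq) (+-comm (toℕ a) n)))

next^k≢id : ∀ {n} {a : Fin n} (k : ℕ) → 0 < k → k < n → next^ k a ≢ a
next^k≢id {n} {a} k 0<k k<n eq with toℕ-next^ a k (<⇒≤ k<n)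
... | inj₁ p = <-irrefl (sym (+-cancelˡ-≡ (toℕ a) k 0 a+k≡a+0)) 0<k
  where
  a+k≡a+0 = trans p (trans (cong toℕ eq) (sym (+-identityʳ _)))
... | inj₂ p = <-irrefl (+-cancelˡ-≡ (toℕ a) k n a+k≡a+n) k<n
  where
  a+k≡a+n = trans p (trans (cong (n +_) (cong toℕ eq)) (+-comm n (toℕ a)))

data NextWalk {n} : ℕ → Fin n → Fin n → Set where
  []   : NextWalk 0 a a
  _∷ʳ_ : NextWalk m a b → Next n b c → NextWalk (suc m) a c

infixl 5 _∷ʳ_

NextWalk⇒next^ : NextWalk m a b → next^ m a ≡ b
NextWalk⇒next^ []         = refl
NextWalk⇒next^ (ps ∷ʳ p) = trans (cong next (NextWalk⇒next^ ps)) (sym (Next⇒≡next p))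

noShortClosedWalk : ∀ {n k} {a : Fin n} → 0 < k → k < n → ¬ NextWalk k a a
noShortClosedWalk 0<k k<n ps = next^k≢id _ 0<k k<n (NextWalk⇒next^ ps)

prev : Fin n → Fin n
prev {suc m} = next^ m

Next-prev : (a : Fin n) → Next n (prev a) a
Next-prev {suc m} a = subst (Next (suc m) (next^ m a)) (next^n≡id a) (Next-next (next^ m a))

next≢prev : 2 < n → (a : Fin n) → next a ≢ prev a
next≢prev 2<n a eq =
  noShortClosedWalk z<s 2<n ([] ∷ʳ Next-next a ∷ʳ subst (λ b → Next _ b a) (sym eq) (Next-prev a))

CycAdj-triangleFree : 3 < n → CycAdj n a b → CycAdj n b c → CycAdj n c a →
                      a ≢ b → b ≢ c → c ≢ a → ⊥
CycAdj-triangleFree 3<n (inj₁ p) (inj₁ q) (inj₁ r) _ _ _ = noShortClosedWalk z<s 3<n ([] ∷ʳ p ∷ʳ q ∷ʳ r)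
CycAdj-triangleFree 3<n (inj₂ p) (inj₂ q) (inj₂ r) _ _ _ = noShortClosedWalk z<s 3<n ([] ∷ʳ r ∷ʳ q ∷ʳ p)
CycAdj-triangleFree _ (inj₁ p) (inj₁ q) (inj₂ r) _ b≢c _ = b≢c (Next-functional p r)
CycAdj-triangleFree _ (inj₁ p) (inj₂ q) _        _ _ c≢a = c≢a (Next-injective q p)
CycAdj-triangleFree _ (inj₂ p) (inj₁ q) _        _ _ c≢a = c≢a (Next-functional q p)
CycAdj-triangleFree _ (inj₂ p) (inj₂ q) (inj₁ r) a≢b _ _ = a≢b (Next-functional r q)

CycAdj-squareFree : 4 < n → CycAdj n a b → CycAdj n b c → CycAdj n c d → CycAdj n d a →
                    a ≢ c → b ≢ d → ⊥
CycAdj-squareFree 4<n (inj₁ p) (inj₁ q) (inj₁ r) (inj₁ s) _ _ =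
  noShortClosedWalk z<s 4<n ([] ∷ʳ p ∷ʳ q ∷ʳ r ∷ʳ s)
CycAdj-squareFree 4<n (inj₂ p) (inj₂ q) (inj₂ r) (inj₂ s) _ _ =
  noShortClosedWalk z<s 4<n ([] ∷ʳ s ∷ʳ r ∷ʳ q ∷ʳ p)
CycAdj-squareFree _ (inj₁ p) (inj₂ q) _ _ a≢c _ = a≢c (Next-injective p q)
CycAdj-squareFree _ (inj₂ p) (inj₁ q) _ _ a≢c _ = a≢c (Next-functional p q)
CycAdj-squareFree _ _ (inj₁ q) (inj₂ r) _ _ b≢d = b≢d (Next-injective q r)
CycAdj-squareFree _ _ (inj₂ q) (inj₁ r) _ _ b≢d = b≢d (Next-functional q r)
CycAdj-squareFree _ _ _ (inj₁ r) (inj₂ s) a≢c _ = a≢c (sym (Next-injective r s))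
CycAdj-squareFree _ _ _ (inj₂ r) (inj₁ s) a≢c _ = a≢c (sym (Next-functional r s))

twoColouring⇒even : (colour : Fin n → Bool) → (∀ a → colour (next a) ≡ not (colour a)) → 2 ∣ n
twoColouring⇒even {zero} _ _ = 2 ∣0
twoColouring⇒even {suc m} colour flips = returnsEven (suc m) (cong colour (next^n≡id zero))
  where
  returnsEven : ∀ k → colour (next^ k zero) ≡ colour zero → 2 ∣ k
  returnsEven zero _ = 2 ∣0
  returnsEven (suc zero) eq = ⊥-elim (not-¬ eq (flips zero))
  returnsEven (suc (suc k)) eq = ∣m∣n⇒∣m+n (∣-refl {2}) (returnsEven k (trans (sym twice) eq))
    where
    twice : colour (next^ (suc (suc k)) zero) ≡ colour (next^ k zero)
    twice = trans (flips _) (trans (cong not (flips _)) (not-involutive _))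

HasCycle≥3 : (N : ℕ) → (Fin N → Fin N → Set) → Set
HasCycle≥3 N _~_ = Σ ℕ λ k → 3 ≤ k × Σ (Fin k → Fin N) λ v →
  Injective _≡_ _≡_ v × (∀ i j → Next k i j → v i ~ v j)

InjectiveBelow : {A : Set} → (ℕ → A) → ℕ → Set
InjectiveBelow w k = ∀ {i j} → i < k → j < k → w i ≡ w j → i ≡ j

module _ {N : ℕ} (w : ℕ → Fin N) where

  Repetition : Set
  Repetition = ∃₂ λ j k → j < k × w j ≡ w k × InjectiveBelow w k

  private
    injectiveBelow-suc : ∀ {k} → InjectiveBelow w k → (∀ {j} → j < k → w j ≢ w k) →
                         InjectiveBelow w (suc k)
    injectiveBelow-suc inj fresh i<1+k j<1+k eq with m<1+n⇒m<n∨m≡n i<1+k | m<1+n⇒m<n∨m≡n j<1+k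
    ... | inj₁ i<k  | inj₁ j<k  = inj i<k j<k eq
    ... | inj₁ i<k  | inj₂ refl = ⊥-elim (fresh i<k eq)
    ... | inj₂ refl | inj₁ j<k  = ⊥-elim (fresh j<k (sym eq))
    ... | inj₂ refl | inj₂ refl = refl

    injectiveBelowOrRepetition : ∀ k → InjectiveBelow w k ⊎ Repetition
    injectiveBelowOrRepetition zero = inj₁ λ ()
    injectiveBelowOrRepetition (suc k) with injectiveBelowOrRepetition k
    ... | inj₂ rep = inj₂ rep
    ... | inj₁ inj with anyUpTo? (λ j → w j ≟ w k) k
    ...   | yes (j , j<k , wj≡wk) = inj₂ (j , k , j<k , wj≡wk , inj)
    ...   | no none = inj₁ (injectiveBelow-suc inj λ j<k wj≡wk → none (_ , j<k , wj≡wk))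

  firstRepetition : Repetition
  firstRepetition with injectiveBelowOrRepetition (suc N)
  ... | inj₂ rep = rep
  ... | inj₁ inj = ⊥-elim (<⇒notInjective {f = λ (i : Fin (suc N)) → w (toℕ i)} ≤-refl
                             λ eq → toℕ-injective (inj (toℕ<n _) (toℕ<n _) eq))

module _ {N : ℕ} {_~_ : Fin N → Fin N → Set} (irrefl : ∀ {x y} → x ~ y → x ≢ y) where

  closedWalk⇒cycle : (u : ℕ → Fin N) → (∀ i → u i ~ u (suc i)) → (∀ i → u (suc (suc i)) ≢ u i) →
                     ∀ ℓ → 0 < ℓ → u ℓ ≡ u 0 → InjectiveBelow u ℓ → HasCycle≥3 N _~_
  closedWalk⇒cycle u step nonBacktracking ℓ 0<ℓ closes inj =
    ℓ , length≥3 ℓ 0<ℓ closes , (λ i → u (toℕ i)) ,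
    (λ eq → toℕ-injective (inj (toℕ<n _) (toℕ<n _) eq)) , steps
    where
    length≥3 : ∀ ℓ → 0 < ℓ → u ℓ ≡ u 0 → 3 ≤ ℓ
    length≥3 1 _ u₁≡u₀ = ⊥-elim (irrefl (step 0) (sym u₁≡u₀))
    length≥3 2 _ u₂≡u₀ = ⊥-elim (nonBacktracking 0 u₂≡u₀)
    length≥3 (suc (suc (suc _))) _ _ = s≤s (s≤s (s≤s z≤n))

    steps : ∀ i j → Next ℓ i j → u (toℕ i) ~ u (toℕ j)
    steps i j (inj₁ 1+i≡j) = subst (λ k → u (toℕ i) ~ u k) 1+i≡j (step (toℕ i))
    steps i j (inj₂ (1+i≡ℓ , j≡0)) =
      subst (u (toℕ i) ~_) (trans (cong u 1+i≡ℓ) (trans closes (cong u (sym j≡0)))) (step (toℕ i))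

  nonBacktrackingWalk⇒cycle : (w : ℕ → Fin N) → (∀ i → w i ~ w (suc i)) →
                              (∀ i → w (suc (suc i)) ≢ w i) → HasCycle≥3 N _~_
  nonBacktrackingWalk⇒cycle w step nonBacktracking with firstRepetition w
  ... | j , k , j<k , wj≡wk , inj with m≤n⇒∃[o]m+o≡n j<k
  ... | o , 1+j+o≡k = closedWalk⇒cycle (λ i → w (j + i)) step′ nonBacktracking′ (suc o) z<s closes inj′
    where
    j+1+o≡k : j + suc o ≡ k
    j+1+o≡k = trans (+-suc j o) 1+j+o≡k

    step′ : ∀ i → w (j + i) ~ w (j + suc i)
    step′ i = subst (λ l → w (j + i) ~ w l) (sym (+-suc j i)) (step (j + i))

    nonBacktracking′ : ∀ i → w (j + suc (suc i)) ≢ w (j + i)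
    nonBacktracking′ i = subst (λ l → w l ≢ w (j + i))
      (sym (trans (+-suc j (suc i)) (cong suc (+-suc j i)))) (nonBacktracking (j + i))

    closes : w (j + suc o) ≡ w (j + 0)
    closes = trans (cong w j+1+o≡k) (trans (sym wj≡wk) (cong w (sym (+-identityʳ j))))

    inj′ : InjectiveBelow (λ i → w (j + i)) (suc o)
    inj′ a<ℓ b<ℓ eq = +-cancelˡ-≡ j _ _ (inj (below a<ℓ) (below b<ℓ) eq)
      where
      below : ∀ {i} → i < suc o → j + i < k
      below i<ℓ = subst (j + _ <_) j+1+o≡k (+-monoʳ-< j i<ℓ)

  module _ (P : Fin N → Set) (extend : ∀ {x y} → x ~ y → P y → ∃ λ z → z ≢ x × y ~ z × P z) where

    private
      State : Set
      State = Σ (Fin N) λ x → Σ (Fin N) λ y → x ~ y × P y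

      advance : State → State
      advance (_ , y , x~y , Py) = let z , _ , y~z , Pz = extend x~y Py in y , z , y~z , Pz

      arc : ∀ s → proj₁ s ~ proj₁ (advance s)
      arc (_ , _ , x~y , _) = x~y

      avoids : ∀ s → proj₁ (advance (advance s)) ≢ proj₁ s
      avoids (_ , _ , x~y , Py) = proj₁ (proj₂ (extend x~y Py))

    extendable⇒cycle : ∀ {x y} → x ~ y → P y → HasCycle≥3 N _~_
    extendable⇒cycle x~y Py =
      nonBacktrackingWalk⇒cycle (λ i → proj₁ (states i)) (λ i → arc (states i)) (λ i → avoids (states i))
      where
      states : ℕ → State
      states = fold (_ , _ , x~y , Py) advance

module Conflict (D : Multidigraph) where

  private
    E = Fin (ne D)
    V = Fin (nv D)
    s = src D
    t = tgt D
    _~_ = LFAdj D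
    U = UAdj D
    variable
      e f g : E
      u v w x y : V

  LFAdj-sym : e ~ f → f ~ e
  LFAdj-sym (e≢f , inj₁ p)                   = ≢-sym e≢f , inj₁ (sym p)
  LFAdj-sym (e≢f , inj₂ (inj₁ p))            = ≢-sym e≢f , inj₂ (inj₁ (sym p))
  LFAdj-sym (e≢f , inj₂ (inj₂ (inj₁ (p , q)))) = ≢-sym e≢f , inj₂ (inj₂ (inj₁ (sym p , sym q)))
  LFAdj-sym (e≢f , inj₂ (inj₂ (inj₂ (p , q)))) = ≢-sym e≢f , inj₂ (inj₂ (inj₂ (sym q , sym p)))

  sameSource : e ≢ f → s e ≡ s f → e ~ f
  sameSource e≢f p = e≢f , inj₁ p

  sameTarget : e ≢ f → t e ≡ t f → e ~ f
  sameTarget e≢f p = e≢f , inj₂ (inj₁ p)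

  opposite : s e ≡ t f → t e ≡ s f → s e ≢ t e → e ~ f
  opposite p q se≢te = (λ { refl → se≢te p }) , inj₂ (inj₂ (inj₂ (p , q)))

  ConflictCase : E → E → Set
  ConflictCase e f = s e ≡ s f ⊎ t e ≡ t f ⊎ (s e ≡ t f × t e ≡ s f)

  LFAdj-cases : e ~ f → ConflictCase e f
  LFAdj-cases (_ , inj₁ p)                   = inj₁ p
  LFAdj-cases (_ , inj₂ (inj₁ p))            = inj₂ (inj₁ p)
  LFAdj-cases (_ , inj₂ (inj₂ (inj₁ (p , _)))) = inj₁ p
  LFAdj-cases (_ , inj₂ (inj₂ (inj₂ pq)))    = inj₂ (inj₂ pq)

  LFAdj⇒shareEndpoint : (∀ e f → ¬ TwoCycle D e f) → e ~ f → s e ≡ s f ⊎ t e ≡ t f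
  LFAdj⇒shareEndpoint {e} {f} noTwoCycle e~f with LFAdj-cases e~f
  ... | inj₁ p        = inj₁ p
  ... | inj₂ (inj₁ p) = inj₂ p
  ... | inj₂ (inj₂ (p , q)) = ⊥-elim (noTwoCycle e f (proj₁ e~f , p , sym q))

  Arc : V → V → Set
  Arc u v = ∃ λ e → s e ≡ u × t e ≡ v

  arc? : ∀ u v → Dec (Arc u v)
  arc? u v = any? λ e → (s e ≟ u) ×-dec (t e ≟ v)

  Arc⇒UAdj : u ≢ v → Arc u v → U u v
  Arc⇒UAdj u≢v (e , p , q) = u≢v , e , inj₁ (p , q)

  UAdj-sym : U u v → U v u
  UAdj-sym (u≢v , e , inj₁ pq) = ≢-sym u≢v , e , inj₂ pq
  UAdj-sym (u≢v , e , inj₂ pq) = ≢-sym u≢v , e , inj₁ pq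

  uAdj? : ∀ u v → Dec (U u v)
  uAdj? u v = ¬? (u ≟ v) ×-dec any? λ e →
    ((s e ≟ u) ×-dec (t e ≟ v)) ⊎-dec ((s e ≟ v) ×-dec (t e ≟ u))

  PendantAt : V → V → Set
  PendantAt u v =
    u ≢ v × Arc u v × Arc v u × (∀ e → s e ≡ u → t e ≡ v) × (∀ e → t e ≡ u → s e ≡ v)

  Pendant : V → Set
  Pendant u = ∃ (PendantAt u)

  pendant? : ∀ u → Dec (Pendant u)
  pendant? u = any? λ v → ¬? (u ≟ v) ×-dec arc? u v ×-dec arc? v u ×-dec
    all? (λ e → (s e ≟ u) →-dec (t e ≟ v)) ×-dec all? (λ e → (t e ≟ u) →-dec (s e ≟ v))

  PendantAt-uniqueNeighbour : PendantAt u v → U w u → w ≡ v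
  PendantAt-uniqueNeighbour (_ , _ , _ , _ , incoming) (_ , e , inj₁ (se≡w , te≡u)) =
    trans (sym se≡w) (incoming e te≡u)
  PendantAt-uniqueNeighbour (_ , _ , _ , outgoing , _) (_ , e , inj₂ (se≡u , te≡w)) =
    trans (sym te≡w) (outgoing e se≡u)

  module UnderlyingCycle
    (digraph : IsDigraph D) (e₀ : E)
    (triangleFree : ∀ {e f g} → e ~ f → f ~ g → g ~ e → ⊥)
    (squareFree : ∀ {e f g h} → e ~ f → f ~ g → g ~ h → h ~ e → e ≢ g → f ≢ h → ⊥)
    (twoNeighbours : ∀ e → ∃₂ λ f g → f ≢ g × e ~ f × e ~ g)
    where

    arc-unique : s e ≡ u → t e ≡ v → s f ≡ u → t f ≡ v → e ≡ f
    arc-unique {e = e} {f = f} p q p′ q′ =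
      decidable-stable (e ≟ f) λ e≢f → digraph e f (e≢f , trans p (sym p′) , trans q (sym q′))

    loops-nonAdjacent : s e ≡ t e → s f ≡ t f → ¬ (e ~ f)
    loops-nonAdjacent {e} {f} e-loop f-loop e~f =
      proj₁ e~f (arc-unique refl (sym e-loop) (sym se≡sf) (trans (sym f-loop) (sym se≡sf)))
      where
      se≡sf : s e ≡ s f
      se≡sf with LFAdj-cases e~f
      ... | inj₁ p              = p
      ... | inj₂ (inj₁ p)       = trans e-loop (trans p (sym f-loop))
      ... | inj₂ (inj₂ (p , _)) = trans p (sym f-loop)

    neighbourOtherThan : ∀ e h → ∃ λ f → e ~ f × f ≢ h
    neighbourOtherThan e h with twoNeighbours e
    ... | f , g , f≢g , e~f , e~g with f ≟ h
    ...   | no f≢h   = f , e~f , f≢h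
    ...   | yes refl = g , e~g , ≢-sym f≢g

    notAllNeighboursShareSource : ∀ e → ¬ (∀ {f} → e ~ f → s e ≡ s f)
    notAllNeighboursShareSource e all with twoNeighbours e
    ... | f , g , f≢g , e~f , e~g =
      triangleFree e~f (sameSource f≢g (trans (sym (all e~f)) (all e~g))) (LFAdj-sym e~g)

    notAllNeighboursShareTarget : ∀ e → ¬ (∀ {f} → e ~ f → t e ≡ t f)
    notAllNeighboursShareTarget e all with twoNeighbours e
    ... | f , g , f≢g , e~f , e~g =
      triangleFree e~f (sameTarget f≢g (trans (sym (all e~f)) (all e~g))) (LFAdj-sym e~g)

    Joins : E → V → V → Set
    Joins e u v = s e ≡ u × t e ≡ v ⊎ s e ≡ v × t e ≡ u

    joins-adjacent : u ≢ v → Joins e u v → Joins f u v → e ≢ f → e ~ f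
    joins-adjacent _ (inj₁ (p , q)) (inj₁ (p′ , q′)) e≢f = ⊥-elim (e≢f (arc-unique p q p′ q′))
    joins-adjacent _ (inj₂ (p , q)) (inj₂ (p′ , q′)) e≢f = ⊥-elim (e≢f (arc-unique p q p′ q′))
    joins-adjacent u≢v (inj₁ (p , q)) (inj₂ (p′ , q′)) _ =
      opposite (trans p (sym q′)) (trans q (sym p′)) λ se≡te → u≢v (trans (sym p) (trans se≡te q))
    joins-adjacent u≢v (inj₂ (p , q)) (inj₁ (p′ , q′)) _ =
      opposite (trans p (sym q′)) (trans q (sym p′)) λ se≡te → u≢v (trans (sym q) (trans (sym se≡te) p))

    -- A loop at y, or a single arc between x and y, would conflict with two edges that conflict
    -- with each other.
    module SoleNeighbour {x y : V} (xy : U x y) (sole : ∀ z → U y z → z ≡ x) where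

      private
        y≢x : y ≢ x
        y≢x = ≢-sym (proj₁ xy)

        leaves-to-x : ∀ h → s h ≡ y → t h ≢ y → t h ≡ x
        leaves-to-x h sh≡y th≢y = sole (t h) (≢-sym th≢y , h , inj₁ (sh≡y , refl))

        enters-from-x : ∀ h → t h ≡ y → s h ≢ y → s h ≡ x
        enters-from-x h th≡y sh≢y = sole (s h) (≢-sym sh≢y , h , inj₂ (refl , th≡y))

      noLoop : ∀ l → s l ≡ y → t l ≡ y → ⊥
      noLoop l sl≡y tl≡y with twoNeighbours l
      ... | f , g , f≢g , l~f , l~g =
        triangleFree l~f (joins-adjacent y≢x (joins l~f) (joins l~g) f≢g) (LFAdj-sym l~g)
        where
        joins : ∀ {f} → l ~ f → Joins f y x
        joins {f} l~f = classify (LFAdj-cases l~f)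
          where
          f-nonLoop : s f ≢ t f
          f-nonLoop sf≡tf = loops-nonAdjacent (trans sl≡y (sym tl≡y)) sf≡tf l~f

          classify : ConflictCase l f → Joins f y x
          classify (inj₁ p) = let sf≡y = trans (sym p) sl≡y in
            inj₁ (sf≡y , leaves-to-x f sf≡y λ tf≡y → f-nonLoop (trans sf≡y (sym tf≡y)))
          classify (inj₂ (inj₁ p)) = let tf≡y = trans (sym p) tl≡y in
            inj₂ (enters-from-x f tf≡y (λ sf≡y → f-nonLoop (trans sf≡y (sym tf≡y))) , tf≡y)
          classify (inj₂ (inj₂ (p , q))) =
            ⊥-elim (f-nonLoop (trans (sym q) (trans tl≡y (trans (sym sl≡y) p))))

      outgoing : ∀ h → s h ≡ y → t h ≡ x
      outgoing h sh≡y with t h ≟ y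
      ... | yes th≡y = ⊥-elim (noLoop h sh≡y th≡y)
      ... | no th≢y  = leaves-to-x h sh≡y th≢y

      incoming : ∀ h → t h ≡ y → s h ≡ x
      incoming h th≡y with s h ≟ y
      ... | yes sh≡y = ⊥-elim (noLoop h sh≡y th≡y)
      ... | no sh≢y  = enters-from-x h th≡y sh≢y

      forward⇒backward : Arc x y → Arc y x
      forward⇒backward (e , se≡x , te≡y) = decidable-stable (arc? y x) λ ¬yx →
        notAllNeighboursShareSource e λ e~f → shareSource ¬yx e~f (LFAdj-cases e~f)
        where
        shareSource : ¬ Arc y x → e ~ f → ConflictCase e f → s e ≡ s f
        shareSource _ _ (inj₁ p) = p
        shareSource {f} _ e~f (inj₂ (inj₁ p)) = let tf≡y = trans (sym p) te≡y in
          ⊥-elim (proj₁ e~f (arc-unique se≡x te≡y (incoming f tf≡y) tf≡y))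
        shareSource {f} ¬yx _ (inj₂ (inj₂ (p , q))) =
          ⊥-elim (¬yx (f , trans (sym q) te≡y , trans (sym p) se≡x))

      backward⇒forward : Arc y x → Arc x y
      backward⇒forward (e , se≡y , te≡x) = decidable-stable (arc? x y) λ ¬xy →
        notAllNeighboursShareTarget e λ e~f → shareTarget ¬xy e~f (LFAdj-cases e~f)
        where
        shareTarget : ¬ Arc x y → e ~ f → ConflictCase e f → t e ≡ t f
        shareTarget {f} _ e~f (inj₁ p) = let sf≡y = trans (sym p) se≡y in
          ⊥-elim (proj₁ e~f (arc-unique se≡y te≡x sf≡y (outgoing f sf≡y)))
        shareTarget _ _ (inj₂ (inj₁ p)) = p
        shareTarget {f} ¬xy _ (inj₂ (inj₂ (p , q))) =
          ⊥-elim (¬xy (f , trans (sym q) te≡x , trans (sym p) se≡y))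

      pendant : Pendant y
      pendant = x , y≢x , proj₁ arcs , proj₂ arcs , outgoing , incoming
        where
        arcs : Arc y x × Arc x y
        arcs with proj₂ xy
        ... | e , inj₁ (se≡x , te≡y) = forward⇒backward (e , se≡x , te≡y) , (e , se≡x , te≡y)
        ... | e , inj₂ (se≡y , te≡x) = (e , se≡y , te≡x) , backward⇒forward (e , se≡y , te≡x)

    nonPendant⇒otherNeighbour : U x y → ¬ Pendant y → ∃ λ z → z ≢ x × U y z
    nonPendant⇒otherNeighbour {x} {y} xy ¬py =
      decidable-stable (any? λ z → ¬? (z ≟ x) ×-dec uAdj? y z) λ none →
        ¬py (SoleNeighbour.pendant xy λ z yz → decidable-stable (z ≟ x) λ z≢x → none (z , z≢x , yz))

    module PendantPartner {a b : V} {e r : E} (a≢b : a ≢ b)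
      (se≡a : s e ≡ a) (te≡b : t e ≡ b) (sr≡b : s r ≡ b) (tr≡a : t r ≡ a)
      (outgoing : ∀ h → s h ≡ a → t h ≡ b) (incoming : ∀ h → t h ≡ a → s h ≡ b) where

      private
        e~r : e ~ r
        e~r = opposite (trans se≡a (sym tr≡a)) (trans te≡b (sym sr≡b))
                λ se≡te → a≢b (trans (sym se≡a) (trans se≡te te≡b))

        noTwoCycleWithThird : ∀ {c} → c ≢ a → c ≢ b → Arc c b → Arc b c → ⊥
        noTwoCycleWithThird c≢a c≢b (f , sf≡c , tf≡b) (g , sg≡b , tg≡c) =
          squareFree e~f f~g g~r (LFAdj-sym e~r) e≢g f≢r
          where
          e~f : e ~ f
          e~f = sameTarget (λ { refl → c≢a (trans (sym sf≡c) se≡a) }) (trans te≡b (sym tf≡b))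
          f~g : f ~ g
          f~g = opposite (trans sf≡c (sym tg≡c)) (trans tf≡b (sym sg≡b))
                  λ sf≡tf → c≢b (trans (sym sf≡c) (trans sf≡tf tf≡b))
          g~r : g ~ r
          g~r = sameSource (λ { refl → c≢a (trans (sym tg≡c) tr≡a) }) (trans sg≡b (sym sr≡b))
          e≢g : e ≢ g
          e≢g refl = a≢b (trans (sym se≡a) sg≡b)
          f≢r : f ≢ r
          f≢r refl = a≢b (trans (sym tr≡a) tf≡b)

        third-nonPendant : ∀ {c} → c ≢ a → c ≢ b → U b c → ¬ Pendant c
        third-nonPendant c≢a c≢b bc (b′ , pc@(_ , cb′ , b′c , _))
          with refl ← PendantAt-uniqueNeighbour pc bc = noTwoCycleWithThird c≢a c≢b cb′ b′c

        enteringThird : ∃ λ c → c ≢ a × c ≢ b × Arc c b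
        enteringThird with neighbourOtherThan e r
        ... | f , e~f , f≢r with LFAdj-cases e~f
        ...   | inj₁ p = let sf≡a = trans (sym p) se≡a in
          ⊥-elim (proj₁ e~f (arc-unique se≡a te≡b sf≡a (outgoing f sf≡a)))
        ...   | inj₂ (inj₂ (p , q)) =
          ⊥-elim (f≢r (arc-unique (trans (sym q) te≡b) (trans (sym p) se≡a) sr≡b tr≡a))
        ...   | inj₂ (inj₁ p) = s f , sf≢a , sf≢b , (f , refl , tf≡b)
          where
          tf≡b = trans (sym p) te≡b
          sf≢a : s f ≢ a
          sf≢a sf≡a = proj₁ e~f (arc-unique se≡a te≡b sf≡a tf≡b)
          sf≢b : s f ≢ b
          sf≢b sf≡b = triangleFree e~f (sameSource f≢r (trans sf≡b (sym sr≡b))) (LFAdj-sym e~r)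

        leavingThird : ∃ λ d → d ≢ a × d ≢ b × Arc b d
        leavingThird with neighbourOtherThan r e
        ... | g , r~g , g≢e with LFAdj-cases r~g
        ...   | inj₂ (inj₁ p) = let tg≡a = trans (sym p) tr≡a in
          ⊥-elim (proj₁ r~g (arc-unique sr≡b tr≡a (incoming g tg≡a) tg≡a))
        ...   | inj₂ (inj₂ (p , q)) =
          ⊥-elim (g≢e (arc-unique (trans (sym q) tr≡a) (trans (sym p) sr≡b) se≡a te≡b))
        ...   | inj₁ p = t g , tg≢a , tg≢b , (g , sg≡b , refl)
          where
          sg≡b = trans (sym p) sr≡b
          tg≢a : t g ≢ a
          tg≢a tg≡a = proj₁ r~g (arc-unique sr≡b tr≡a sg≡b tg≡a)
          tg≢b : t g ≢ b
          tg≢b tg≡b = triangleFree r~g (sameTarget g≢e (trans tg≡b (sym te≡b))) e~r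

      twoNonPendantNeighbours : ∃₂ λ c d → c ≢ d × U b c × U b d × ¬ Pendant c × ¬ Pendant d
      twoNonPendantNeighbours with enteringThird | leavingThird
      ... | c , c≢a , c≢b , cb | d , d≢a , d≢b , bd =
        c , d , (λ { refl → noTwoCycleWithThird c≢a c≢b cb bd }) , bc , Arc⇒UAdj (≢-sym d≢b) bd ,
        third-nonPendant c≢a c≢b bc , third-nonPendant d≢a d≢b (Arc⇒UAdj (≢-sym d≢b) bd)
        where
        bc : U b c
        bc = UAdj-sym (Arc⇒UAdj c≢b cb)

    partner-nonPendantNeighbourAvoiding : PendantAt u v → ∀ x → ∃ λ z → z ≢ x × U v z × ¬ Pendant z
    partner-nonPendantNeighbourAvoiding (u≢v , (_ , se≡u , te≡v) , (_ , sr≡v , tr≡u) , out , inc) x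
      with PendantPartner.twoNonPendantNeighbours u≢v se≡u te≡v sr≡v tr≡u out inc
    ... | c , d , c≢d , vc , vd , ¬pc , ¬pd with c ≟ x
    ...   | yes refl = d , ≢-sym c≢d , vd , ¬pd
    ...   | no c≢x   = c , c≢x , vc , ¬pc

    extend : U x y → ¬ Pendant y → ∃ λ z → z ≢ x × U y z × ¬ Pendant z
    extend {x} xy ¬py with nonPendant⇒otherNeighbour xy ¬py
    ... | z , z≢x , yz with pendant? z
    ...   | no ¬pz = z , z≢x , yz , ¬pz
    ...   | yes (_ , pz) rewrite PendantAt-uniqueNeighbour pz yz =
      partner-nonPendantNeighbourAvoiding pz x

    nonLoopEdge : ∃ λ e → s e ≢ t e
    nonLoopEdge with s e₀ ≟ t e₀
    ... | no e₀-nonLoop = e₀ , e₀-nonLoop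
    ... | yes e₀-loop   = let f , _ , _ , e₀~f , _ = twoNeighbours e₀ in
                          f , λ f-loop → loops-nonAdjacent e₀-loop f-loop e₀~f

    start : ∃₂ λ x y → U x y × ¬ Pendant y
    start with nonLoopEdge
    ... | e , se≢te with pendant? (t e)
    ...   | no ¬p       = s e , t e , Arc⇒UAdj se≢te (e , refl , refl) , ¬p
    ...   | yes (v , p) =
      let z , _ , vz , ¬pz = partner-nonPendantNeighbourAvoiding p (t e) in v , z , vz , ¬pz

    underlyingCycle : HasUnderlyingCycle≥3 D
    underlyingCycle = let x , y , xy , ¬py = start in
      extendable⇒cycle proj₁ (λ y → ¬ Pendant y) extend xy ¬py

  module AlternatingTrail
    (noTwoCycle : ∀ e f → ¬ TwoCycle D e f)
    (triangleFree : ∀ {e f g} → e ~ f → f ~ g → g ~ e → ⊥)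
    {n : ℕ} (2<n : 2 < n) (σ : Fin n → E) (σ-injective : Injective _≡_ _≡_ σ)
    (consecutive : ∀ {a b} → Next n a b → σ a ~ σ b) where

    alternating : ∀ a b → Next n a b → s (σ a) ≡ s (σ b) ⊎ t (σ a) ≡ t (σ b)
    alternating _ _ p = LFAdj⇒shareEndpoint noTwoCycle (consecutive p)

    isAltClosedTrail : IsAltClosedTrail D n σ
    isAltClosedTrail = σ-injective , alternating

    sharesSourceWithNext : Fin n → Bool
    sharesSourceWithNext a = does (s (σ a) ≟ s (σ (next a)))

    private
      step : ∀ a → σ a ~ σ (next a)
      step a = consecutive (Next-next a)

      σ-next² : ∀ a → σ (next (next a)) ≢ σ a
      σ-next² a eq = next^k≢id 2 z<s 2<n (σ-injective eq)

    sharesSourceWithNext-flips : ∀ a → sharesSourceWithNext (next a) ≡ not (sharesSourceWithNext a)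
    sharesSourceWithNext-flips a with s (σ a) ≟ s (σ (next a)) | s (σ (next a)) ≟ s (σ (next (next a)))
    ... | yes p | yes q =
      ⊥-elim (triangleFree (step a) (step (next a)) (sameSource (σ-next² a) (sym (trans p q))))
    ... | yes _ | no _  = refl
    ... | no _  | yes _ = refl
    ... | no ¬p | no ¬q with alternating _ _ (Next-next a) | alternating _ _ (Next-next (next a))
    ...   | inj₁ p | _      = ⊥-elim (¬p p)
    ...   | inj₂ _ | inj₁ q = ⊥-elim (¬q q)
    ...   | inj₂ p | inj₂ q =
      ⊥-elim (triangleFree (step a) (step (next a)) (sameTarget (σ-next² a) (sym (trans p q))))

    even : 2 ∣ n
    even = twoColouring⇒even sharesSourceWithNext sharesSourceWithNext-flips

  module CycleIsomorphism {n : ℕ} (σ : Fin n ⤖ E) (iso : IsCycleIso D n σ) where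

    open Bijection σ using (to; injective; surjection)
    open Surjection surjection using (to⁻; to∘to⁻)

    CycAdj⇒LFAdj : CycAdj n a b → to a ~ to b
    CycAdj⇒LFAdj = proj₂ (iso _ _)

    private
      LFAdj⇒CycAdj : e ~ f → CycAdj n (to⁻ e) (to⁻ f)
      LFAdj⇒CycAdj {e} {f} e~f = proj₁ (iso _ _) (subst₂ _~_ (sym (to∘to⁻ e)) (sym (to∘to⁻ f)) e~f)

      to⁻-≢ : e ≢ f → to⁻ e ≢ to⁻ f
      to⁻-≢ {e} {f} e≢f eq = e≢f (trans (sym (to∘to⁻ e)) (trans (cong to eq) (to∘to⁻ f)))

    triangleFree : 3 < n → e ~ f → f ~ g → g ~ e → ⊥
    triangleFree 3<n e~f f~g g~e = CycAdj-triangleFree 3<n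
      (LFAdj⇒CycAdj e~f) (LFAdj⇒CycAdj f~g) (LFAdj⇒CycAdj g~e)
      (to⁻-≢ (proj₁ e~f)) (to⁻-≢ (proj₁ f~g)) (to⁻-≢ (proj₁ g~e))

    squareFree : ∀ {h} → 4 < n → e ~ f → f ~ g → g ~ h → h ~ e → e ≢ g → f ≢ h → ⊥
    squareFree 4<n e~f f~g g~h h~e e≢g f≢h = CycAdj-squareFree 4<n
      (LFAdj⇒CycAdj e~f) (LFAdj⇒CycAdj f~g) (LFAdj⇒CycAdj g~h) (LFAdj⇒CycAdj h~e)
      (to⁻-≢ e≢g) (to⁻-≢ f≢h)

    twoNeighbours : 2 < n → ∀ e → ∃₂ λ f g → f ≢ g × e ~ f × e ~ g
    twoNeighbours 2<n e =
      to (next (to⁻ e)) , to (prev (to⁻ e)) , (λ eq → next≢prev 2<n (to⁻ e) (injective eq)) ,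
      neighbour (inj₁ (Next-next (to⁻ e))) , neighbour (inj₂ (Next-prev (to⁻ e)))
      where
      neighbour : ∀ {a} → CycAdj n (to⁻ e) a → e ~ to a
      neighbour {a} p = subst (λ x → x ~ to a) (to∘to⁻ e) (CycAdj⇒LFAdj p)

lemma3p8 : (D : Multidigraph) → IsDigraph D → (n : ℕ) → 5 ≤ n →
    (σ : Fin n ⤖ Fin (ne D)) → IsCycleIso D n σ →
    HasUnderlyingCycle≥3 D ×
    (IsSimpleDigraph D → IsAltClosedTrail D n (Bijection.to σ) × 2 ∣ n)
lemma3p8 D digraph n@(suc _) 5≤n σ iso =
  UnderlyingCycle.underlyingCycle digraph (to zero)
    (triangleFree 3<n) (squareFree 5≤n) (twoNeighbours 2<n) ,
  λ (_ , noTwoCycle) → let open AlternatingTrail noTwoCycle (triangleFree 3<n) 2<n to injective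
                                  (λ p → CycAdj⇒LFAdj (inj₁ p))
                       in isAltClosedTrail , even
  where
  open Conflict D
  open CycleIsomorphism σ iso
  open Bijection σ using (to; injective)
  3<n : 3 < n
  3<n = <⇒≤ 5≤n
  2<n : 2 < n
  2<n = <⇒≤ 3<n
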